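{- For every fixed integer $k\ge 1$, there are only finitely many (up to isomorphism) $k$-vertex-critical $(P_5,P_2+2P_1)$-free graphs.
   Context: All graphs are finite and simple. $P_t$ is the path on $t$ vertices; $P_2+2P_1$ is the disjoint union of an edge and two isolated vertices. A graph is $(P_5,P_2+2P_1)$-free if it has no induced subgraph isomorphic to $P_5$ or to $P_2+2P_1$. A graph $G$ is $k$-vertex-critical if $\chi(G)=k$ and $\chi(G-v)<k$ for every vertex $v$, where $\chi$ is the chromatic number. -}

module Defs where

open import Data.Nat using (ℕ; zero; suc; pred; _<_)
open import Data.Fin using (Fin; zero; suc; punchIn)
open import Data.Bool using (Bool; true; false)
open import Data.Product using (Σ; _×_; _,_; ∃)
open import Relation.Binary.PropositionalEquality using (_≡_; _≢_; refl)
open import Relation.Nullary using (¬_)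
open import Function.Definitions using (Injective; Bijective)

record Graph (n : ℕ) : Set where
  field
    adj    : Fin n → Fin n → Bool
    sym    : ∀ i j → adj i j ≡ adj j i
    irrefl : ∀ i → adj i i ≡ false
open Graph public

Iso : ∀ {n m} → Graph n → Graph m → Set
Iso {n} {m} G H = Σ (Fin n → Fin m) λ f →
  Bijective _≡_ _≡_ f × (∀ i j → adj H (f i) (f j) ≡ adj G i j)

InducedSub : ∀ {m n} → Graph m → Graph n → Set
InducedSub {m} {n} H G = Σ (Fin m → Fin n) λ f →
  Injective _≡_ _≡_ f × (∀ i j → adj G (f i) (f j) ≡ adj H i j)

Free : ∀ {m n} → Graph m → Graph n → Set
Free H G = ¬ InducedSub H G

-- The path P5 : 0 - 1 - 2 - 3 - 4.
p5adj : Fin 5 → Fin 5 → Bool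
p5adj zero (suc zero) = true
p5adj (suc zero) zero = true
p5adj (suc zero) (suc (suc zero)) = true
p5adj (suc (suc zero)) (suc zero) = true
p5adj (suc (suc zero)) (suc (suc (suc zero))) = true
p5adj (suc (suc (suc zero))) (suc (suc zero)) = true
p5adj (suc (suc (suc zero))) (suc (suc (suc (suc zero)))) = true
p5adj (suc (suc (suc (suc zero)))) (suc (suc (suc zero))) = true
p5adj _ _ = false

P5 : Graph 5
P5 = record { adj = p5adj ; sym = s ; irrefl = r }
  where
  s : ∀ i j → p5adj i j ≡ p5adj j i
  s zero zero = refl
  s zero (suc zero) = refl
  s zero (suc (suc zero)) = refl
  s zero (suc (suc (suc zero))) = refl
  s zero (suc (suc (suc (suc zero)))) = refl
  s (suc zero) zero = refl
  s (suc zero) (suc zero) = refl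
  s (suc zero) (suc (suc zero)) = refl
  s (suc zero) (suc (suc (suc zero))) = refl
  s (suc zero) (suc (suc (suc (suc zero)))) = refl
  s (suc (suc zero)) zero = refl
  s (suc (suc zero)) (suc zero) = refl
  s (suc (suc zero)) (suc (suc zero)) = refl
  s (suc (suc zero)) (suc (suc (suc zero))) = refl
  s (suc (suc zero)) (suc (suc (suc (suc zero)))) = refl
  s (suc (suc (suc zero))) zero = refl
  s (suc (suc (suc zero))) (suc zero) = refl
  s (suc (suc (suc zero))) (suc (suc zero)) = refl
  s (suc (suc (suc zero))) (suc (suc (suc zero))) = refl
  s (suc (suc (suc zero))) (suc (suc (suc (suc zero)))) = refl
  s (suc (suc (suc (suc zero)))) zero = refl
  s (suc (suc (suc (suc zero)))) (suc zero) = refl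
  s (suc (suc (suc (suc zero)))) (suc (suc zero)) = refl
  s (suc (suc (suc (suc zero)))) (suc (suc (suc zero))) = refl
  s (suc (suc (suc (suc zero)))) (suc (suc (suc (suc zero)))) = refl
  r : ∀ i → p5adj i i ≡ false
  r zero = refl
  r (suc zero) = refl
  r (suc (suc zero)) = refl
  r (suc (suc (suc zero))) = refl
  r (suc (suc (suc (suc zero)))) = refl

p2p1adj : Fin 4 → Fin 4 → Bool
p2p1adj zero (suc zero) = true
p2p1adj (suc zero) zero = true
p2p1adj _ _ = false

P2+2P1 : Graph 4
P2+2P1 = record { adj = p2p1adj ; sym = s ; irrefl = r }
  where
  s : ∀ i j → p2p1adj i j ≡ p2p1adj j i
  s zero zero = refl
  s zero (suc zero) = refl
  s zero (suc (suc zero)) = refl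
  s zero (suc (suc (suc zero))) = refl
  s (suc zero) zero = refl
  s (suc zero) (suc zero) = refl
  s (suc zero) (suc (suc zero)) = refl
  s (suc zero) (suc (suc (suc zero))) = refl
  s (suc (suc zero)) zero = refl
  s (suc (suc zero)) (suc zero) = refl
  s (suc (suc zero)) (suc (suc zero)) = refl
  s (suc (suc zero)) (suc (suc (suc zero))) = refl
  s (suc (suc (suc zero))) zero = refl
  s (suc (suc (suc zero))) (suc zero) = refl
  s (suc (suc (suc zero))) (suc (suc zero)) = refl
  s (suc (suc (suc zero))) (suc (suc (suc zero))) = refl
  r : ∀ i → p2p1adj i i ≡ false
  r zero = refl
  r (suc zero) = refl
  r (suc (suc zero)) = refl
  r (suc (suc (suc zero))) = refl

Colorable : ∀ {n} → Graph n → ℕ → Set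
Colorable {n} G c = Σ (Fin n → Fin c) λ f →
  ∀ i j → adj G i j ≡ true → f i ≢ f j

ChromaticNumber : ∀ {n} → Graph n → ℕ → Set
ChromaticNumber G k = Colorable G k × (∀ c → c < k → ¬ Colorable G c)

deleteVertex : ∀ {n} → Graph n → Fin n → Graph (pred n)
deleteVertex {suc m} G v = record
  { adj    = λ i j → adj G (punchIn v i) (punchIn v j)
  ; sym    = λ i j → sym G (punchIn v i) (punchIn v j)
  ; irrefl = λ i → irrefl G (punchIn v i)
  }

VertexCritical : ℕ → ∀ {n} → Graph n → Set
VertexCritical k {n} G = ChromaticNumber G k ×
  (∀ (v : Fin n) → ∃ λ c → c < k × ChromaticNumber (deleteVertex G v) c)

-- A k-vertex-critical graph G has no clique on k + 1 vertices, and no vertex x whose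
-- neighbourhood lies inside that of another vertex y: colour G - x with fewer than k colours
-- and give x the colour of y. In a (P5, P2+2P1)-free graph the second property turns an
-- independent set I of size at least 3 into a clique of the same size. For y ∈ I pick a
-- neighbour z_y of another vertex of I that misses y; P2+2P1-freeness makes z_y adjacent to
-- all of I - y, and a non-edge z_y z_y′ would give the induced path y - z_y′ - x - z_y - y′
-- for a third x ∈ I. So G has fewer than k + 2 independent vertices, Ramsey's theorem bounds
-- its order by R(k + 2, k + 2), and there are only finitely many graphs of bounded order.

module Submission where

open import Defs hiding (sym)
open import Data.Nat using (ℕ; zero; suc; _≤_; _<_; _+_; _^_; s≤s; _≤?_)
open import Data.Nat.Properties using (+-mono-<; <⇒≱; ≰⇒>; ≮⇒≥; ≤-trans; ≤-reflexive; +-suc; m+n≮n)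
open import Data.Fin using (Fin; zero; suc; punchIn; punchOut; _≟_; finToFun; funToFin) renaming (_<_ to _<ᶠ_)
open import Data.Fin.Patterns using (0F; 1F; 2F; 3F)
open import Data.Fin.Properties
  using (2↔Bool; all?; ¬∀⟶∃¬; pigeonhole; <⇒≢; <-cmp; _<?_; punchIn-punchOut; finToFun-funToFin)
open import Data.Bool using (Bool; true; false; _∧_) renaming (_≟_ to _≟ᵇ_)
open import Data.Bool.Properties using (¬-not; ∧-comm; ∧-idem)
open import Data.Product using (Σ; ∃; _×_; _,_; proj₁; proj₂)
open import Data.Sum using (_⊎_; inj₁; inj₂)
open import Data.Empty using (⊥-elim)
open import Data.List using (List; []; _∷_; length; filter; allFin; cartesianProduct; concatMap; map; upTo)
open import Data.List.Properties using (length-tabulate)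
open import Data.List.Relation.Unary.Any using (Any; here; there)
import Data.List.Relation.Unary.Any.Properties as Any
open import Data.List.Relation.Unary.All using (All; []; _∷_)
import Data.List.Relation.Unary.All as All
open import Data.List.Relation.Unary.All.Properties using (all-filter)
import Data.List.Relation.Unary.All.Properties as All
open import Data.List.Relation.Unary.AllPairs using (_∷_)
open import Data.List.Relation.Unary.Unique.Propositional using (Unique)
open import Data.List.Relation.Unary.Unique.Propositional.Properties using (allFin⁺)
import Data.List.Relation.Unary.Unique.Propositional.Properties as Unique
open import Data.List.Membership.Propositional using (_∈_; lose)
open import Data.List.Membership.Propositional.Properties
  using (∈-filter⁺; ∈-cartesianProduct⁺; ∈-allFin; ∈-upTo⁺)
open import Data.List.Relation.Binary.Subset.Propositional.Properties using (∷⁺ʳ; filter-⊆)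
open import Data.Vec using (Vec; lookup; _∷_; [])
import Data.Vec.Functional as Vector
open import Relation.Binary.Definitions using (tri<; tri≈; tri>)
open import Relation.Binary.PropositionalEquality
open import Relation.Nullary using (¬_; Dec; yes; no; does)
open import Relation.Nullary.Decidable using (_→-dec_; _⊎-dec_; _×-dec_; from-yes)
open import Relation.Unary using (Decidable)
open import Relation.Unary.Properties using (∁?)
open import Function using (_∘_; id; case_of_)
open import Function.Definitions using (Injective)
open import Function.Bundles using (Inverse)
open import Function.Construct.Identity using (bijective)

adj-comm : ∀ {n} (G : Graph n) {u v b} → adj G u v ≡ b → adj G v u ≡ b
adj-comm G {u} {v} uv = trans (Graph.sym G v u) uv

IsClique : ∀ {n s} → Graph n → (Fin s → Fin n) → Set
IsClique G c = ∀ {i j} → i ≢ j → adj G (c i) (c j) ≡ true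

IsIndependent : ∀ {n t} → Graph n → (Fin t → Fin n) → Set
IsIndependent G c = Injective _≡_ _≡_ c × (∀ i j → adj G (c i) (c j) ≡ false)

colorable⇒clique≤ : ∀ {n s k} {G : Graph n} → Colorable G k →
  (c : Fin s → Fin n) → IsClique G c → s ≤ k
colorable⇒clique≤ (colour , proper) c clique = ≮⇒≥ λ k<s →
  let i , j , i<j , same = pigeonhole k<s (colour ∘ c)
  in proper (c i) (c j) (clique (<⇒≢ i<j)) same

PreservesAdjacency : ∀ {m n} → Graph m → Graph n → (Fin m → Fin n) → Set
PreservesAdjacency H G f = ∀ i j → adj G (f i) (f j) ≡ adj H i j

AgreesOn : ∀ {m n} → Graph m → Graph n → (Fin m → Fin n) → Fin m × Fin m → Set
AgreesOn H G f (i , j) = adj G (f i) (f j) ≡ adj H i j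

-- Lexicographic, so an All over orderedPairs m lists facts for (0,1), (0,2), …, (m-2,m-1) in this order.
orderedPairs : (m : ℕ) → List (Fin m × Fin m)
orderedPairs m = filter (λ p → proj₁ p <? proj₂ p) (cartesianProduct (allFin m) (allFin m))

∈-orderedPairs : ∀ {m} {i j : Fin m} → i <ᶠ j → (i , j) ∈ orderedPairs m
∈-orderedPairs {i = i} {j} i<j =
  ∈-filter⁺ (λ p → proj₁ p <? proj₂ p) (∈-cartesianProduct⁺ (∈-allFin i) (∈-allFin j)) i<j

preservesAdjacency-fromOrderedPairs : ∀ {m n} {H : Graph m} {G : Graph n} {f : Fin m → Fin n} →
  All (AgreesOn H G f) (orderedPairs m) → PreservesAdjacency H G f
preservesAdjacency-fromOrderedPairs {H = H} {G} {f} agree i j with <-cmp i j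
... | tri< i<j _ _ = All.lookup agree (∈-orderedPairs i<j)
... | tri≈ _ refl _ = trans (irrefl G (f i)) (sym (irrefl H i))
... | tri> _ _ j<i = trans (adj-comm G (All.lookup agree (∈-orderedPairs j<i))) (Graph.sym H j i)

Twins : ∀ {m} → Graph m → Fin m → Fin m → Set
Twins H i j = ∀ k → adj H i k ≡ adj H j k

twins? : ∀ {m} (H : Graph m) i j → Dec (Twins H i j)
twins? H i j = all? λ k → adj H i k ≟ᵇ adj H j k

collision⇒twins : ∀ {m n} {H : Graph m} {G : Graph n} {f : Fin m → Fin n} →
  PreservesAdjacency H G f → ∀ {i j} → f i ≡ f j → Twins H i j
collision⇒twins {G = G} {f} preserves {i} {j} fi≡fj k = begin
  _              ≡⟨ sym (preserves i k) ⟩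
  adj G (f i) (f k) ≡⟨ cong (λ v → adj G v (f k)) fi≡fj ⟩
  adj G (f j) (f k) ≡⟨ preserves j k ⟩
  _              ∎
  where open ≡-Reasoning

P5-twinFree : ∀ i j → Twins P5 i j → i ≡ j
P5-twinFree = from-yes (all? λ i → all? λ j → twins? P5 i j →-dec i ≟ j)

P2+2P1-twins : ∀ i j → Twins P2+2P1 i j → i ≡ j ⊎ (i ≡ 2F × j ≡ 3F) ⊎ (i ≡ 3F × j ≡ 2F)
P2+2P1-twins = from-yes (all? λ i → all? λ j → twins? P2+2P1 i j →-dec
  (i ≟ j ⊎-dec (i ≟ 2F ×-dec j ≟ 3F) ⊎-dec (i ≟ 3F ×-dec j ≟ 2F)))

module _ {n} (G : Graph n) where

  inducedP5 : (v : Vec (Fin n) 5) → All (AgreesOn P5 G (lookup v)) (orderedPairs 5) →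
    InducedSub P5 G
  inducedP5 v agree = lookup v , injective , preserves
    where
    preserves : PreservesAdjacency P5 G (lookup v)
    preserves = preservesAdjacency-fromOrderedPairs {H = P5} {G} agree
    injective : Injective _≡_ _≡_ (lookup v)
    injective {i} {j} = P5-twinFree i j ∘ collision⇒twins {H = P5} {G} preserves

  inducedP2+2P1 : (v : Vec (Fin n) 4) → lookup v 2F ≢ lookup v 3F →
    All (AgreesOn P2+2P1 G (lookup v)) (orderedPairs 4) → InducedSub P2+2P1 G
  inducedP2+2P1 v v₂≢v₃ agree = lookup v , injective , preserves
    where
    preserves : PreservesAdjacency P2+2P1 G (lookup v)
    preserves = preservesAdjacency-fromOrderedPairs {H = P2+2P1} {G} agree
    injective : Injective _≡_ _≡_ (lookup v)
    injective {i} {j} vi≡vj with P2+2P1-twins i j (collision⇒twins {H = P2+2P1} {G} preserves vi≡vj)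
    ... | inj₁ i≡j = i≡j
    ... | inj₂ (inj₁ (refl , refl)) = ⊥-elim (v₂≢v₃ vi≡vj)
    ... | inj₂ (inj₂ (refl , refl)) = ⊥-elim (v₂≢v₃ (sym vi≡vj))

Dominates : ∀ {n} → Graph n → Fin n → Fin n → Set
Dominates G y x = ∀ z → adj G x z ≡ true → adj G y z ≡ true

PrivateNeighbour : ∀ {n} → Graph n → Fin n → Fin n → Set
PrivateNeighbour G x y = ∃ λ z → adj G x z ≡ true × adj G y z ≡ false

module _ {m} {G : Graph (suc m)} {x y : Fin (suc m)} (x≢y : x ≢ y) (dominates : Dominates G y x) where

  collapse : Fin (suc m) → Fin m
  collapse v with v ≟ x
  ... | yes _ = punchOut x≢y
  ... | no v≢x = punchOut (v≢x ∘ sym)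

  collapse-preserves-edge : ∀ u w → adj G u w ≡ true → adj G (punchIn x (collapse u)) w ≡ true
  collapse-preserves-edge u w uw with u ≟ x
  ... | yes refl = subst (λ v → adj G v w ≡ true) (sym (punchIn-punchOut x≢y)) (dominates w uw)
  ... | no u≢x = subst (λ v → adj G v w ≡ true) (sym (punchIn-punchOut (u≢x ∘ sym))) uw

  deleteVertex-colorable⇒colorable : ∀ {c} → Colorable (deleteVertex G x) c → Colorable G c
  deleteVertex-colorable⇒colorable (colour , proper) = colour ∘ collapse , λ u w uw →
    proper (collapse u) (collapse w)
      (adj-comm G (collapse-preserves-edge w _ (adj-comm G (collapse-preserves-edge u w uw))))

vertexCritical⇒privateNeighbour : ∀ {k n} {G : Graph n} → VertexCritical k G →
  ∀ {x y} → x ≢ y → PrivateNeighbour G x y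
vertexCritical⇒privateNeighbour {n = zero} _ {()}
vertexCritical⇒privateNeighbour {n = suc m} {G} ((_ , noFewerColours) , critical) {x} {y} x≢y =
  let z , ¬xz⇒yz = ¬∀⟶∃¬ (suc m) (λ z → adj G x z ≡ true → adj G y z ≡ true)
                     (λ z → (adj G x z ≟ᵇ true) →-dec (adj G y z ≟ᵇ true)) ¬dominates
  in z , counterexample ¬xz⇒yz
  where
  counterexample : ∀ {a b} → ¬ (a ≡ true → b ≡ true) → a ≡ true × b ≡ false
  counterexample {true} {true} ¬a⇒b = ⊥-elim (¬a⇒b λ _ → refl)
  counterexample {true} {false} _ = refl , refl
  counterexample {false} ¬a⇒b = ⊥-elim (¬a⇒b λ ())

  ¬dominates : ¬ Dominates G y x
  ¬dominates dominates =
    let c , c<k , (colourable , _) = critical x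
    in noFewerColours c c<k (deleteVertex-colorable⇒colorable {G = G} x≢y dominates colourable)

avoid-two : ∀ {t} (y y′ : Fin (3 + t)) → ∃ λ x → x ≢ y × x ≢ y′
avoid-two 0F 0F = 1F , (λ ()) , (λ ())
avoid-two 0F 1F = 2F , (λ ()) , (λ ())
avoid-two 0F (suc (suc _)) = 1F , (λ ()) , (λ ())
avoid-two 1F 0F = 2F , (λ ()) , (λ ())
avoid-two 1F (suc _) = 0F , (λ ()) , (λ ())
avoid-two (suc (suc _)) 0F = 1F , (λ ()) , (λ ())
avoid-two (suc (suc _)) (suc _) = 0F , (λ ()) , (λ ())

module _ {n} {G : Graph n} (p5-free : Free P5 G) (p2+2p1-free : Free P2+2P1 G)
  (privateNeighbour : ∀ {x y} → x ≢ y → PrivateNeighbour G x y) where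

  independent⇒clique : ∀ {t} (I : Fin (3 + t) → Fin n) → IsIndependent G I →
    ∃ λ (Z : Fin (3 + t) → Fin n) → IsClique G Z
  independent⇒clique {t} I (I-injective , I-independent) = Z , Z-clique
    where
    other : Fin (3 + t) → Fin (3 + t)
    other y = proj₁ (avoid-two y y)

    private-of : ∀ y → PrivateNeighbour G (I (other y)) (I y)
    private-of y = privateNeighbour (proj₁ (proj₂ (avoid-two y y)) ∘ I-injective)

    Z : Fin (3 + t) → Fin n
    Z y = proj₁ (private-of y)

    Z-sees-others : ∀ y w → w ≢ y → adj G (I w) (Z y) ≡ true
    Z-sees-others y w w≢y with adj G (I w) (Z y) in Iw~Zy
    ... | true = refl
    ... | false = ⊥-elim (p2+2p1-free (inducedP2+2P1 G
          (Z y ∷ I (other y) ∷ I y ∷ I w ∷ [])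
          (λ Iy≡Iw → w≢y (I-injective (sym Iy≡Iw)))
          (adj-comm G (proj₁ (proj₂ (private-of y))) ∷ adj-comm G (proj₂ (proj₂ (private-of y)))
           ∷ adj-comm G Iw~Zy ∷ I-independent (other y) y ∷ I-independent (other y) w ∷ I-independent y w ∷ [])))

    Z-clique : IsClique G Z
    Z-clique {y} {y′} y≢y′ with adj G (Z y) (Z y′) in Zy~Zy′ | avoid-two y y′
    ... | true | _ = refl
    ... | false | x , x≢y , x≢y′ = ⊥-elim (p5-free (inducedP5 G
          (I y ∷ Z y′ ∷ I x ∷ Z y ∷ I y′ ∷ [])
          (Z-sees-others y′ y y≢y′ ∷ I-independent y x ∷ proj₂ (proj₂ (private-of y)) ∷ I-independent y y′
           ∷ adj-comm G (Z-sees-others y′ x x≢y′) ∷ adj-comm G Zy~Zy′ ∷ adj-comm G (proj₂ (proj₂ (private-of y′)))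
           ∷ Z-sees-others y x x≢y ∷ I-independent x y′
           ∷ adj-comm G (Z-sees-others y y′ (y≢y′ ∘ sym)) ∷ [])))

ramseyBound : ℕ → ℕ → ℕ
ramseyBound zero t = 0
ramseyBound (suc s) zero = 0
ramseyBound (suc s) (suc t) = suc (ramseyBound s (suc t) + ramseyBound (suc s) t)

m+n≤o+p⇒m≤o⊎n≤p : ∀ m n o p → m + n ≤ o + p → m ≤ o ⊎ n ≤ p
m+n≤o+p⇒m≤o⊎n≤p m n o p m+n≤o+p with m ≤? o | n ≤? p
... | yes m≤o | _ = inj₁ m≤o
... | no _ | yes n≤p = inj₂ n≤p
... | no m≰o | no n≰p = ⊥-elim (<⇒≱ (+-mono-< (≰⇒> m≰o) (≰⇒> n≰p)) m+n≤o+p)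

length-filter+length-filter-∁ : ∀ {A : Set} {P : A → Set} (P? : Decidable P) xs →
  length (filter P? xs) + length (filter (∁? P?) xs) ≡ length xs
length-filter+length-filter-∁ P? [] = refl
length-filter+length-filter-∁ P? (x ∷ xs) with does (P? x)
... | true = cong suc (length-filter+length-filter-∁ P? xs)
... | false = trans (+-suc _ _) (cong suc (length-filter+length-filter-∁ P? xs))

module _ {n} (G : Graph n) where

  CliqueIn : ℕ → List (Fin n) → Set
  CliqueIn s L = Σ (Fin s → Fin n) λ c → (∀ i → c i ∈ L) × IsClique G c

  IndependentIn : ℕ → List (Fin n) → Set
  IndependentIn t L = Σ (Fin t → Fin n) λ c → (∀ i → c i ∈ L) × IsIndependent G c

  cliqueIn-cons : ∀ {s v xs} → All (λ u → adj G v u ≡ true) xs →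
    CliqueIn s xs → CliqueIn (suc s) (v ∷ xs)
  cliqueIn-cons {v = v} {xs} v~xs (c , c∈xs , clique) = v Vector.∷ c , ∈v∷xs , clique′
    where
    ∈v∷xs : ∀ i → (v Vector.∷ c) i ∈ (v ∷ xs)
    ∈v∷xs zero = here refl
    ∈v∷xs (suc i) = there (c∈xs i)
    clique′ : IsClique G (v Vector.∷ c)
    clique′ {zero} {zero} 0≢0 = ⊥-elim (0≢0 refl)
    clique′ {zero} {suc j} _ = All.lookup v~xs (c∈xs j)
    clique′ {suc i} {zero} _ = adj-comm G (All.lookup v~xs (c∈xs i))
    clique′ {suc i} {suc j} i≢j = clique (i≢j ∘ cong suc)

  independentIn-cons : ∀ {t v xs} → All (v ≢_) xs → All (λ u → ¬ adj G v u ≡ true) xs →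
    IndependentIn t xs → IndependentIn (suc t) (v ∷ xs)
  independentIn-cons {v = v} {xs} v∉xs v≁xs (c , c∈xs , injective , independent) =
    v Vector.∷ c , ∈v∷xs , (λ {i} {j} → injective′ i j) , independent′
    where
    ∈v∷xs : ∀ i → (v Vector.∷ c) i ∈ (v ∷ xs)
    ∈v∷xs zero = here refl
    ∈v∷xs (suc i) = there (c∈xs i)
    v≁ : ∀ i → adj G v (c i) ≡ false
    v≁ i = ¬-not (All.lookup v≁xs (c∈xs i))
    injective′ : ∀ i j → (v Vector.∷ c) i ≡ (v Vector.∷ c) j → i ≡ j
    injective′ zero zero _ = refl
    injective′ zero (suc j) v≡cj = ⊥-elim (All.lookup v∉xs (c∈xs j) v≡cj)
    injective′ (suc i) zero ci≡v = ⊥-elim (All.lookup v∉xs (c∈xs i) (sym ci≡v))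
    injective′ (suc i) (suc j) ci≡cj = cong suc (injective ci≡cj)
    independent′ : ∀ i j → adj G ((v Vector.∷ c) i) ((v Vector.∷ c) j) ≡ false
    independent′ zero zero = irrefl G v
    independent′ zero (suc j) = v≁ j
    independent′ (suc i) zero = adj-comm G (v≁ i)
    independent′ (suc i) (suc j) = independent i j

  cliqueIn-⊆ : ∀ {s xs ys} → (∀ {u} → u ∈ xs → u ∈ ys) → CliqueIn s xs → CliqueIn s ys
  cliqueIn-⊆ xs⊆ys (c , c∈xs , clique) = c , xs⊆ys ∘ c∈xs , clique

  independentIn-⊆ : ∀ {t xs ys} → (∀ {u} → u ∈ xs → u ∈ ys) → IndependentIn t xs → IndependentIn t ys
  independentIn-⊆ xs⊆ys (c , c∈xs , independent) = c , xs⊆ys ∘ c∈xs , independent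

  adjacent? : ∀ v → Decidable (λ u → adj G v u ≡ true)
  adjacent? v u = adj G v u ≟ᵇ true

  nonAdjacent? : ∀ v → Decidable (λ u → ¬ adj G v u ≡ true)
  nonAdjacent? v = ∁? (adjacent? v)

  ramsey : ∀ s t {L} → Unique L → ramseyBound s t ≤ length L → CliqueIn s L ⊎ IndependentIn t L
  ramsey zero t _ _ = inj₁ ((λ ()) , (λ ()) , λ { {()} })
  ramsey (suc s) zero _ _ = inj₂ ((λ ()) , (λ ()) , (λ { {()} }) , λ ())
  ramsey (suc s) (suc t) {v ∷ xs} (v∉xs ∷ unique) (s≤s enough)
    with m+n≤o+p⇒m≤o⊎n≤p (ramseyBound s (suc t)) (ramseyBound (suc s) t)
           (length (filter (adjacent? v) xs)) (length (filter (nonAdjacent? v) xs))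
           (≤-trans enough (≤-reflexive (sym (length-filter+length-filter-∁ (adjacent? v) xs))))
  ... | inj₁ enough-neighbours
    with ramsey s (suc t) (Unique.filter⁺ (adjacent? v) unique) enough-neighbours
  ...   | inj₁ clique = inj₁ (cliqueIn-⊆ (∷⁺ʳ v (filter-⊆ (adjacent? v) xs))
          (cliqueIn-cons (all-filter (adjacent? v) xs) clique))
  ...   | inj₂ independent = inj₂ (independentIn-⊆ (there ∘ filter-⊆ (adjacent? v) xs) independent)
  ramsey (suc s) (suc t) {v ∷ xs} (v∉xs ∷ unique) (s≤s enough)
    | inj₂ enough-nonNeighbours
    with ramsey (suc s) t (Unique.filter⁺ (nonAdjacent? v) unique) enough-nonNeighbours
  ...   | inj₁ clique = inj₁ (cliqueIn-⊆ (there ∘ filter-⊆ (nonAdjacent? v) xs) clique)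
  ...   | inj₂ independent = inj₂ (independentIn-⊆ (∷⁺ʳ v (filter-⊆ (nonAdjacent? v) xs))
          (independentIn-cons (All.filter⁺ (nonAdjacent? v) v∉xs) (all-filter (nonAdjacent? v) xs) independent))

-- 3 + k exceeds the clique bound suc k and is at least 3, as independent⇒clique requires.
vertexCritical-order< : ∀ {k n} {G : Graph n} →
  VertexCritical (suc k) G → Free P5 G → Free P2+2P1 G → n < ramseyBound (3 + k) (3 + k)
vertexCritical-order< {k} {n} {G} critical p5-free p2+2p1-free = ≰⇒> λ bound≤n →
  case ramsey G (3 + k) (3 + k) (allFin⁺ n) (≤-trans bound≤n (≤-reflexive (length-allFin n))) of λ where
    (inj₁ (c , _ , clique)) → no-large-clique c clique
    (inj₂ (I , _ , independent)) →
      let Z , clique = independent⇒clique {G = G} p5-free p2+2p1-free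
                         (vertexCritical⇒privateNeighbour critical) I independent
      in no-large-clique Z clique
  where
  length-allFin : ∀ n → n ≡ length (allFin n)
  length-allFin n = sym (length-tabulate id)

  no-large-clique : (c : Fin (3 + k) → Fin n) → ¬ IsClique G c
  no-large-clique c = m+n≮n 1 (suc k) ∘ colorable⇒clique≤ {G = G} (proj₁ (proj₁ critical)) c

module _ {n} (M : Fin n → Fin n → Bool) where

  symmetricPart : Fin n → Fin n → Bool
  symmetricPart i j with i ≟ j
  ... | yes _ = false
  ... | no _ = M i j ∧ M j i

  symmetricPart-sym : ∀ i j → symmetricPart i j ≡ symmetricPart j i
  symmetricPart-sym i j with i ≟ j | j ≟ i
  ... | yes _ | yes _ = refl
  ... | yes i≡j | no j≢i = ⊥-elim (j≢i (sym i≡j))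
  ... | no i≢j | yes j≡i = ⊥-elim (i≢j (sym j≡i))
  ... | no _ | no _ = ∧-comm (M i j) (M j i)

  symmetricPart-irrefl : ∀ i → symmetricPart i i ≡ false
  symmetricPart-irrefl i with i ≟ i
  ... | yes _ = refl
  ... | no i≢i = ⊥-elim (i≢i refl)

  graphOf : Graph n
  graphOf = record { adj = symmetricPart ; sym = symmetricPart-sym ; irrefl = symmetricPart-irrefl }

iso-graphOf : ∀ {n} (G : Graph n) {M} → (∀ i j → M i j ≡ adj G i j) → Iso G (graphOf M)
iso-graphOf G {M} M≗adj = id , bijective _≡_ , agree
  where
  agree : ∀ i j → symmetricPart M i j ≡ adj G i j
  agree i j with i ≟ j
  ... | yes refl = sym (irrefl G i)
  ... | no _ rewrite M≗adj i j | M≗adj j i | Graph.sym G j i = ∧-idem (adj G i j)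

-- A Boolean matrix is coded by its rows, each row by a number below 2 ^ n.
matrixCode : ∀ {n} → Graph n → Fin ((2 ^ n) ^ n)
matrixCode G = funToFin λ i → funToFin λ j → Inverse.from 2↔Bool (adj G i j)

decodeMatrix : ∀ {n} → Fin ((2 ^ n) ^ n) → Fin n → Fin n → Bool
decodeMatrix c i j = Inverse.to 2↔Bool (finToFun (finToFun c i) j)

decodeMatrix-matrixCode : ∀ {n} (G : Graph n) i j → decodeMatrix (matrixCode G) i j ≡ adj G i j
decodeMatrix-matrixCode G i j = begin
  to (finToFun (finToFun (matrixCode G) i) j)
    ≡⟨ cong (λ row → to (finToFun row j)) (finToFun-funToFin _ i) ⟩
  to (finToFun (funToFin λ j → from (adj G i j)) j)
    ≡⟨ cong to (finToFun-funToFin _ j) ⟩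
  to (from (adj G i j))
    ≡⟨ strictlyInverseˡ (adj G i j) ⟩
  adj G i j
    ∎
  where
  open ≡-Reasoning
  open Inverse 2↔Bool using (to; from; strictlyInverseˡ)

graphsOfOrder : ℕ → List (Σ ℕ Graph)
graphsOfOrder n = map (λ c → n , graphOf (decodeMatrix c)) (allFin ((2 ^ n) ^ n))

graphsOfOrderBelow : ℕ → List (Σ ℕ Graph)
graphsOfOrderBelow b = concatMap graphsOfOrder (upTo b)

graphsOfOrderBelow-complete : ∀ {b n} (G : Graph n) → n < b →
  Any (λ H → Iso G (proj₂ H)) (graphsOfOrderBelow b)
graphsOfOrderBelow-complete G n<b = Any.concatMap⁺ graphsOfOrder (lose (∈-upTo⁺ n<b)
  (Any.map⁺ (lose (∈-allFin (matrixCode G)) (iso-graphOf G (decodeMatrix-matrixCode G)))))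

theorem16 : (k : ℕ) → 1 ≤ k →
    Σ (List (Σ ℕ Graph)) λ L →
      ∀ {n} (G : Graph n) → VertexCritical k G → Free P5 G → Free P2+2P1 G →
        Any (λ H → Iso G (proj₂ H)) L
theorem16 zero ()
theorem16 (suc k) _ = graphsOfOrderBelow (ramseyBound (3 + k) (3 + k)) ,
  λ G critical p5-free p2+2p1-free →
    graphsOfOrderBelow-complete G (vertexCritical-order< critical p5-free p2+2p1-free)
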